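{- Let $A$ be an antipodal $k$-splitting of $Q_2^n$. Then $|u_1\cap u_2|\ge2$ for all $u_1,u_2\in\beta(A)$.
   Context: $Q_2^n=\{0,1\}^n$. An $m$-face of $Q_2^n$ is a tuple $a\in\{0,1,*\}^n$ with exactly $m$ entries $*$, identified with $\{x\in Q_2^n: x_i=a_i$ whenever $a_i\in\{0,1\}\}$. Faces are parallel if their sets of $*$-positions coincide; parallel faces $a,b$ are antipodal if $b_i=1-a_i$ whenever $a_i\ne*$. An antipodal $k$-splitting of $Q_2^n$ is a collection of exactly $2^k$ $(n-k)$-faces whose union is $Q_2^n$ and which contains no two distinct parallel non-antipodal faces. For a face $a$, $\beta(a)=\{i: a_i\in\{0,1\}\}$ (a $k$-subset of $\{1,\dots,n\}$ for an $(n-k)$-face), and $\beta(A)=\{\beta(a):a\in A\}$. -}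

module Defs where

open import Data.Nat using (ℕ; zero; suc; _^_; _∸_)
open import Data.Bool using (Bool; true; false)
open import Data.Fin using (Fin)
open import Data.Vec using (Vec; []; _∷_; lookup; map; countᵇ)
open import Data.Fin.Subset using (Subset; inside; outside)
open import Data.List using (List; length)
open import Data.List.Membership.Propositional using (_∈_)
open import Data.List.Relation.Unary.Unique.Propositional using (Unique)
open import Data.Unit using (⊤)
open import Data.Empty using (⊥)
open import Data.Product using (_×_; ∃-syntax)
open import Relation.Binary.PropositionalEquality using (_≡_; _≢_)

-- An entry of a face: a fixed coordinate 0, a fixed coordinate 1, or a free coordinate *.
data Entry : Set where
  𝟎 𝟏 ⋆ : Entry

Point : ℕ → Set
Point n = Vec Bool n

Face : ℕ → Set
Face n = Vec Entry n

isStar : Entry → Bool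
isStar ⋆ = true
isStar 𝟎 = false
isStar 𝟏 = false

dim : ∀ {n} → Face n → ℕ
dim a = countᵇ isStar a

IsFace : ∀ {n} → ℕ → Face n → Set
IsFace m a = dim a ≡ m

matches : Bool → Entry → Set
matches false 𝟎 = ⊤
matches true  𝟏 = ⊤
matches _     ⋆ = ⊤
matches true  𝟎 = ⊥
matches false 𝟏 = ⊥

_∈F_ : ∀ {n} → Point n → Face n → Set
x ∈F a = ∀ i → matches (lookup x i) (lookup a i)

Parallel : ∀ {n} → Face n → Face n → Set
Parallel a b = ∀ i → isStar (lookup a i) ≡ isStar (lookup b i)

flipE : Entry → Entry
flipE 𝟎 = 𝟏
flipE 𝟏 = 𝟎
flipE ⋆ = ⋆

Antipodal : ∀ {n} → Face n → Face n → Set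
Antipodal a b = Parallel a b × (∀ i → lookup a i ≢ ⋆ → lookup b i ≡ flipE (lookup a i))

fixedSide : Entry → Bool
fixedSide ⋆ = outside
fixedSide 𝟎 = inside
fixedSide 𝟏 = inside

β : ∀ {n} → Face n → Subset n
β a = map fixedSide a

-- Antipodal k-splitting: a collection (duplicate-free list) of exactly 2^k
-- (n-k)-faces covering Q_2^n with no two distinct parallel non-antipodal faces.
record AntipodalSplitting (n k : ℕ) (A : List (Face n)) : Set where
  field
    distinct   : Unique A
    size       : length A ≡ 2 ^ k
    faceDim    : ∀ {a} → a ∈ A → IsFace (n ∸ k) a
    covers     : ∀ (x : Point n) → ∃[ a ] (a ∈ A × x ∈F a)
    antipodal  : ∀ {a b} → a ∈ A → b ∈ A → a ≢ b → Parallel a b → Antipodal a b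

-- Counting points shows that the faces of a splitting partition the cube, so two distinct faces
-- a₁, a₂ must be separated: at some coordinate one has 0 and the other 1. Moreover the antipode
-- of every face b of the splitting belongs to it. Otherwise every other face c has a free
-- coordinate inside β(b) (a face fixed on all of β(b) would be parallel to b, hence antipodal
-- to b), so flipping that coordinate shows that c contains as many points of even as of odd
-- parity on β(b); the same holds for the whole cube, but b lies entirely on one side.
-- Separating a₁ from a₂ and from the antipode of a₂ then yields two distinct coordinates fixed
-- by both faces.
module Submission where

open import Data.Nat using (ℕ; zero; suc; _+_; _*_; _∸_; _^_; _≤_; _<_; z≤n; s≤s)
open import Data.Nat.Properties
open import Algebra.Properties.CommutativeSemigroup +-commutativeSemigroup using (interchange)
open import Data.Nat.ListAction using (sum)
open import Data.Bool using (Bool; true; false; not; _∧_; _xor_)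
open import Data.Bool.Properties using (not-distribˡ-xor; not-distribʳ-xor; xor-same)
open import Data.Fin using (Fin; zero; suc)
open import Data.Fin.Subset using (Subset; inside; outside; _⊆_; _⊂_; _∩_; ∣_∣; ⁅_⁆; Nonempty)
  renaming (_∈_ to _∈ₛ_)
open import Data.Fin.Subset.Properties
  using (_∈?_; ⊆-antisym; p⊂q⇒∣p∣<∣q∣; ∣⁅x⁆∣≡1; x∈⁅y⁆⇒x≡y; x≢y⇒x∉⁅y⁆; ∩-idem;
         nonempty?; Empty-unique; ∣⊥∣≡0)
open import Data.Vec using ([]; _∷_; lookup; map; _[_]=_; here; there; _[_]%=_)
open import Data.Vec.Properties using (lookup-map; ≡-dec)
open import Data.Vec.Relation.Binary.Pointwise.Extensional using (ext; Pointwise-≡⇒≡)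
open import Data.List using (List; []; _∷_; length)
import Data.List as List
open import Data.List.Membership.Propositional using (_∈_)
import Data.List.Membership.DecPropositional as DecMembership
open import Data.List.Relation.Unary.Any using (here; there)
import Data.List.Relation.Unary.All as All
open import Data.List.Relation.Unary.Unique.Propositional using (Unique; []; _∷_)
open import Data.Product using (_×_; _,_; proj₂; ∃-syntax)
open import Data.Sum using (_⊎_; inj₁; inj₂)
open import Data.Empty using (⊥-elim)
open import Function using (_∘_)
open import Relation.Binary using (DecidableEquality)
open import Relation.Nullary using (¬_; yes; no; contradiction)
open import Relation.Binary.PropositionalEquality

open import Defs

⟦_⟧ : Bool → ℕ
⟦ false ⟧ = 0
⟦ true ⟧ = 1

-- Sums over the cube

∑ : ∀ {n} → (Point n → ℕ) → ℕ
∑ {zero} f = f []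
∑ {suc n} f = ∑ (λ x → f (false ∷ x)) + ∑ (λ x → f (true ∷ x))

∑-cong : ∀ {n} {f g : Point n → ℕ} → (∀ x → f x ≡ g x) → ∑ f ≡ ∑ g
∑-cong {zero} f≗g = f≗g []
∑-cong {suc n} f≗g = cong₂ _+_ (∑-cong (f≗g ∘ (false ∷_))) (∑-cong (f≗g ∘ (true ∷_)))

∑-zero : ∀ {n} → ∑ {n} (λ _ → 0) ≡ 0
∑-zero {zero} = refl
∑-zero {suc n} = cong₂ _+_ (∑-zero {n}) (∑-zero {n})

∑-one : ∀ n → ∑ {n} (λ _ → 1) ≡ 2 ^ n
∑-one zero = refl
∑-one (suc n) = cong₂ _+_ (∑-one n) (trans (∑-one n) (sym (+-identityʳ (2 ^ n))))

∑-+ : ∀ {n} (f g : Point n → ℕ) → ∑ (λ x → f x + g x) ≡ ∑ f + ∑ g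
∑-+ {zero} f g = refl
∑-+ {suc n} f g =
  trans (cong₂ _+_ (∑-+ (f ∘ (false ∷_)) (g ∘ (false ∷_))) (∑-+ (f ∘ (true ∷_)) (g ∘ (true ∷_))))
  (interchange (∑ (f ∘ (false ∷_))) (∑ (g ∘ (false ∷_))) (∑ (f ∘ (true ∷_))) (∑ (g ∘ (true ∷_))))

∑-mono-≤ : ∀ {n} {f g : Point n → ℕ} → (∀ x → f x ≤ g x) → ∑ f ≤ ∑ g
∑-mono-≤ {zero} f≤g = f≤g []
∑-mono-≤ {suc n} f≤g = +-mono-≤ (∑-mono-≤ (f≤g ∘ (false ∷_))) (∑-mono-≤ (f≤g ∘ (true ∷_)))

∑-mono-< : ∀ {n} {f g : Point n → ℕ} → (∀ x → f x ≤ g x) → ∀ y → f y < g y → ∑ f < ∑ g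
∑-mono-< {zero} f≤g [] fy<gy = fy<gy
∑-mono-< {suc n} f≤g (false ∷ y) fy<gy =
  +-mono-<-≤ (∑-mono-< (f≤g ∘ (false ∷_)) y fy<gy) (∑-mono-≤ (f≤g ∘ (true ∷_)))
∑-mono-< {suc n} f≤g (true ∷ y) fy<gy =
  +-mono-≤-< (∑-mono-≤ (f≤g ∘ (false ∷_))) (∑-mono-< (f≤g ∘ (true ∷_)) y fy<gy)

∑-flipAt : ∀ {n} (j : Fin n) (f : Point n → ℕ) → ∑ (λ x → f (x [ j ]%= not)) ≡ ∑ f
∑-flipAt zero f = +-comm (∑ (f ∘ (true ∷_))) (∑ (f ∘ (false ∷_)))
∑-flipAt (suc j) f = cong₂ _+_ (∑-flipAt j (f ∘ (false ∷_))) (∑-flipAt j (f ∘ (true ∷_)))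

∑-balanced : ∀ {n} (j : Fin n) (g : Point n → ℕ) (p : Point n → Bool) →
  (∀ x → g (x [ j ]%= not) ≡ g x) → (∀ x → p (x [ j ]%= not) ≡ not (p x)) →
  ∑ (λ x → g x * ⟦ p x ⟧) ≡ ∑ (λ x → g x * ⟦ not (p x) ⟧)
∑-balanced j g p g-invariant p-flips = begin
  ∑ (λ x → g x * ⟦ p x ⟧)                             ≡⟨ ∑-flipAt j _ ⟨
  ∑ (λ x → g (x [ j ]%= not) * ⟦ p (x [ j ]%= not) ⟧) ≡⟨ ∑-cong flipped ⟩
  ∑ (λ x → g x * ⟦ not (p x) ⟧)                       ∎
  where
  open ≡-Reasoning
  flipped : ∀ x → g (x [ j ]%= not) * ⟦ p (x [ j ]%= not) ⟧ ≡ g x * ⟦ not (p x) ⟧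
  flipped x = cong₂ (λ u v → u * ⟦ v ⟧) (g-invariant x) (p-flips x)

module _ {X : Set} where

  sum-map-cong : ∀ (A : List X) {f g : X → ℕ} → (∀ {c} → c ∈ A → f c ≡ g c) →
    sum (List.map f A) ≡ sum (List.map g A)
  sum-map-cong [] f≗g = refl
  sum-map-cong (c ∷ A) f≗g = cong₂ _+_ (f≗g (here refl)) (sum-map-cong A (f≗g ∘ there))

  sum-map-const : ∀ (A : List X) m → sum (List.map (λ _ → m) A) ≡ length A * m
  sum-map-const [] m = refl
  sum-map-const (c ∷ A) m = cong (m +_) (sum-map-const A m)

  sum-map-*ʳ : ∀ (A : List X) (f : X → ℕ) m →
    sum (List.map (λ c → f c * m) A) ≡ sum (List.map f A) * m
  sum-map-*ʳ [] f m = refl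
  sum-map-*ʳ (c ∷ A) f m =
    trans (cong (f c * m +_) (sum-map-*ʳ A f m)) (sym (*-distribʳ-+ m (f c) _))

  ∑-sum-map : ∀ {n} (A : List X) (f : X → Point n → ℕ) →
    ∑ (λ x → sum (List.map (λ c → f c x) A)) ≡ sum (List.map (λ c → ∑ (f c)) A)
  ∑-sum-map {n} [] f = ∑-zero {n}
  ∑-sum-map (c ∷ A) f = trans (∑-+ (f c) _) (cong (∑ (f c) +_) (∑-sum-map A f))

  ∈⇒≤sum-map : ∀ {A : List X} (f : X → ℕ) {c} → c ∈ A → f c ≤ sum (List.map f A)
  ∈⇒≤sum-map f (here refl) = m≤m+n _ _
  ∈⇒≤sum-map {c′ ∷ A} f (there c∈A) = ≤-trans (∈⇒≤sum-map f c∈A) (m≤n+m _ (f c′))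

  ∈-≢⇒+≤sum-map : ∀ {A : List X} (f : X → ℕ) {a c} → a ∈ A → c ∈ A → a ≢ c →
    f a + f c ≤ sum (List.map f A)
  ∈-≢⇒+≤sum-map f (here refl) (here refl) a≢c = contradiction refl a≢c
  ∈-≢⇒+≤sum-map f (here refl) (there c∈A) a≢c = +-monoʳ-≤ (f _) (∈⇒≤sum-map f c∈A)
  ∈-≢⇒+≤sum-map {c′ ∷ A} f (there a∈A) (here refl) a≢c =
    ≤-trans (≤-reflexive (+-comm (f _) (f c′))) (+-monoʳ-≤ (f c′) (∈⇒≤sum-map f a∈A))
  ∈-≢⇒+≤sum-map {c′ ∷ A} f (there a∈A) (there c∈A) a≢c =
    ≤-trans (∈-≢⇒+≤sum-map f a∈A c∈A a≢c) (m≤n+m _ (f c′))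

  sum-map-mono-≤ : ∀ (A : List X) {f g : X → ℕ} → (∀ {c} → c ∈ A → f c ≤ g c) →
    sum (List.map f A) ≤ sum (List.map g A)
  sum-map-mono-≤ [] f≤g = z≤n
  sum-map-mono-≤ (c ∷ A) f≤g = +-mono-≤ (f≤g (here refl)) (sum-map-mono-≤ A (f≤g ∘ there))

  sum-map-mono-< : ∀ (A : List X) {f g : X → ℕ} → (∀ {c} → c ∈ A → f c ≤ g c) →
    ∀ {b} → b ∈ A → f b < g b → sum (List.map f A) < sum (List.map g A)
  sum-map-mono-< (c ∷ A) f≤g (here refl) fb<gb = +-mono-<-≤ fb<gb (sum-map-mono-≤ A (f≤g ∘ there))
  sum-map-mono-< (c ∷ A) f≤g (there b∈A) fb<gb =
    +-mono-≤-< (f≤g (here refl)) (sum-map-mono-< A (f≤g ∘ there) b∈A fb<gb)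

  Unique⇒sum-map-⟦⟧≤1 : ∀ {A : List X} (g : X → Bool) → Unique A →
    (∀ {a c} → a ∈ A → c ∈ A → g a ≡ true → g c ≡ true → a ≡ c) →
    sum (List.map (λ c → ⟦ g c ⟧) A) ≤ 1
  Unique⇒sum-map-⟦⟧≤1 g [] _ = z≤n
  Unique⇒sum-map-⟦⟧≤1 {a ∷ A} g (a∉A ∷ unique) at-most-one with g a in ga
  ... | false = Unique⇒sum-map-⟦⟧≤1 g unique (λ a∈A c∈A → at-most-one (there a∈A) (there c∈A))
  ... | true = ≤-reflexive (cong suc rest-sum≡0)
    where
    rest-false : ∀ {c} → c ∈ A → ⟦ g c ⟧ ≡ 0
    rest-false {c} c∈A with g c in gc
    ... | false = refl
    ... | true = contradiction (at-most-one (here refl) (there c∈A) ga gc) (All.lookup a∉A c∈A)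
    rest-sum≡0 : sum (List.map (λ c → ⟦ g c ⟧) A) ≡ 0
    rest-sum≡0 = trans (sum-map-cong A rest-false) (trans (sum-map-const A 0) (*-zeroʳ (length A)))

2≤∣p∣ : ∀ {n} {p : Subset n} {i j} → i ∈ₛ p → j ∈ₛ p → i ≢ j → 2 ≤ ∣ p ∣
2≤∣p∣ {p = p} {i} {j} i∈p j∈p i≢j = subst (_< ∣ p ∣) (∣⁅x⁆∣≡1 i) (p⊂q⇒∣p∣<∣q∣ ⁅i⁆⊂p)
  where
  ⁅i⁆⊂p : ⁅ i ⁆ ⊂ p
  ⁅i⁆⊂p = (λ x∈⁅i⁆ → subst (_∈ₛ p) (sym (x∈⁅y⁆⇒x≡y i x∈⁅i⁆)) i∈p) , j , j∈p , x≢y⇒x∉⁅y⁆ (i≢j ∘ sym)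

p⊆q∧∣p∣≡∣q∣⇒p≡q : ∀ {n} {p q : Subset n} → p ⊆ q → ∣ p ∣ ≡ ∣ q ∣ → p ≡ q
p⊆q∧∣p∣≡∣q∣⇒p≡q {p = p} {q} p⊆q ∣p∣≡∣q∣ = ⊆-antisym p⊆q q⊆p
  where
  q⊆p : q ⊆ p
  q⊆p {x} x∈q with x ∈? p
  ... | yes x∈p = x∈p
  ... | no x∉p = contradiction ∣p∣≡∣q∣ (<⇒≢ (p⊂q⇒∣p∣<∣q∣ (p⊆q , x , x∈q , x∉p)))

0<∣p∣⇒Nonempty : ∀ {n} (p : Subset n) → 0 < ∣ p ∣ → Nonempty p
0<∣p∣⇒Nonempty {n} p 0<∣p∣ with nonempty? p
... | yes nonempty = nonempty
... | no empty = contradiction (trans (cong ∣_∣ (Empty-unique empty)) (∣⊥∣≡0 n)) (>⇒≢ 0<∣p∣)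

-- Faces

_≟ₑ_ : DecidableEquality Entry
𝟎 ≟ₑ 𝟎 = yes refl
𝟏 ≟ₑ 𝟏 = yes refl
⋆ ≟ₑ ⋆ = yes refl
𝟎 ≟ₑ 𝟏 = no λ ()
𝟎 ≟ₑ ⋆ = no λ ()
𝟏 ≟ₑ 𝟎 = no λ ()
𝟏 ≟ₑ ⋆ = no λ ()
⋆ ≟ₑ 𝟎 = no λ ()
⋆ ≟ₑ 𝟏 = no λ ()

_≟ᶠ_ : ∀ {n} → DecidableEquality (Face n)
_≟ᶠ_ = ≡-dec _≟ₑ_

matchesᵇ : Bool → Entry → Bool
matchesᵇ h 𝟎 = not h
matchesᵇ h 𝟏 = h
matchesᵇ h ⋆ = true

_∈ᵇ_ : ∀ {n} → Point n → Face n → Bool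
[] ∈ᵇ [] = true
(h ∷ x) ∈ᵇ (e ∷ a) = matchesᵇ h e ∧ x ∈ᵇ a

∈F⇒∈ᵇ : ∀ {n} (x : Point n) (a : Face n) → x ∈F a → x ∈ᵇ a ≡ true
∈F⇒∈ᵇ [] [] _ = refl
∈F⇒∈ᵇ (h ∷ x) (e ∷ a) x∈a =
  cong₂ _∧_ (matches⇒matchesᵇ h e (x∈a zero)) (∈F⇒∈ᵇ x a (x∈a ∘ suc))
  where
  matches⇒matchesᵇ : ∀ h e → matches h e → matchesᵇ h e ≡ true
  matches⇒matchesᵇ false 𝟎 _ = refl
  matches⇒matchesᵇ true 𝟏 _ = refl
  matches⇒matchesᵇ _ ⋆ _ = refl
  matches⇒matchesᵇ true 𝟎 ()
  matches⇒matchesᵇ false 𝟏 ()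

∑-∈ᵇ : ∀ {n} (a : Face n) → ∑ (λ x → ⟦ x ∈ᵇ a ⟧) ≡ 2 ^ dim a
∑-∈ᵇ [] = refl
∑-∈ᵇ {suc n} (𝟎 ∷ a) = trans (cong₂ _+_ (∑-∈ᵇ a) (∑-zero {n})) (+-identityʳ _)
∑-∈ᵇ {suc n} (𝟏 ∷ a) = cong₂ _+_ (∑-zero {n}) (∑-∈ᵇ a)
∑-∈ᵇ (⋆ ∷ a) = cong₂ _+_ (∑-∈ᵇ a) (trans (∑-∈ᵇ a) (sym (+-identityʳ _)))

∣β∣+dim≡n : ∀ {n} (a : Face n) → ∣ β a ∣ + dim a ≡ n
∣β∣+dim≡n [] = refl
∣β∣+dim≡n (𝟎 ∷ a) = cong suc (∣β∣+dim≡n a)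
∣β∣+dim≡n (𝟏 ∷ a) = cong suc (∣β∣+dim≡n a)
∣β∣+dim≡n (⋆ ∷ a) = trans (+-suc ∣ β a ∣ (dim a)) (cong suc (∣β∣+dim≡n a))

dim≡0-∈ᵇ⇒≡ : ∀ {n} (x : Point n) {a c : Face n} → dim a ≡ 0 → dim c ≡ 0 →
  x ∈ᵇ a ≡ true → x ∈ᵇ c ≡ true → a ≡ c
dim≡0-∈ᵇ⇒≡ [] {[]} {[]} _ _ _ _ = refl
dim≡0-∈ᵇ⇒≡ (false ∷ x) {𝟎 ∷ a} {𝟎 ∷ c} da dc xa xc = cong (𝟎 ∷_) (dim≡0-∈ᵇ⇒≡ x da dc xa xc)
dim≡0-∈ᵇ⇒≡ (true ∷ x) {𝟏 ∷ a} {𝟏 ∷ c} da dc xa xc = cong (𝟏 ∷_) (dim≡0-∈ᵇ⇒≡ x da dc xa xc)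
dim≡0-∈ᵇ⇒≡ (false ∷ x) {𝟎 ∷ a} {𝟏 ∷ c} _ _ _ ()
dim≡0-∈ᵇ⇒≡ (true ∷ x) {𝟏 ∷ a} {𝟎 ∷ c} _ _ _ ()
dim≡0-∈ᵇ⇒≡ (false ∷ x) {𝟏 ∷ a} _ _ ()
dim≡0-∈ᵇ⇒≡ (true ∷ x) {𝟎 ∷ a} _ _ ()
dim≡0-∈ᵇ⇒≡ (h ∷ x) {⋆ ∷ a} ()
dim≡0-∈ᵇ⇒≡ (h ∷ x) {𝟎 ∷ a} {⋆ ∷ c} _ ()
dim≡0-∈ᵇ⇒≡ (h ∷ x) {𝟏 ∷ a} {⋆ ∷ c} _ ()

data Opposite : Entry → Entry → Set where
  𝟎𝟏 : Opposite 𝟎 𝟏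
  𝟏𝟎 : Opposite 𝟏 𝟎

opposite-or-common : ∀ e f → Opposite e f ⊎ ∃[ h ] (matchesᵇ h e ≡ true × matchesᵇ h f ≡ true)
opposite-or-common 𝟎 𝟏 = inj₁ 𝟎𝟏
opposite-or-common 𝟏 𝟎 = inj₁ 𝟏𝟎
opposite-or-common 𝟎 𝟎 = inj₂ (false , refl , refl)
opposite-or-common 𝟎 ⋆ = inj₂ (false , refl , refl)
opposite-or-common 𝟏 𝟏 = inj₂ (true , refl , refl)
opposite-or-common 𝟏 ⋆ = inj₂ (true , refl , refl)
opposite-or-common ⋆ 𝟎 = inj₂ (false , refl , refl)
opposite-or-common ⋆ 𝟏 = inj₂ (true , refl , refl)
opposite-or-common ⋆ ⋆ = inj₂ (false , refl , refl)

separated-or-meet : ∀ {n} (a c : Face n) →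
  (∃[ i ] Opposite (lookup a i) (lookup c i)) ⊎ (∃[ x ] (x ∈ᵇ a ≡ true × x ∈ᵇ c ≡ true))
separated-or-meet [] [] = inj₂ ([] , refl , refl)
separated-or-meet (e ∷ a) (f ∷ c) with opposite-or-common e f | separated-or-meet a c
... | inj₁ opposite | _ = inj₁ (zero , opposite)
... | inj₂ _ | inj₁ (i , opposite) = inj₁ (suc i , opposite)
... | inj₂ (h , he , hf) | inj₂ (x , xa , xc) = inj₂ (h ∷ x , cong₂ _∧_ he xa , cong₂ _∧_ hf xc)

opposite⇒∈β∩β : ∀ {n} (a c : Face n) i → Opposite (lookup a i) (lookup c i) → i ∈ₛ β a ∩ β c
opposite⇒∈β∩β (e ∷ a) (f ∷ c) zero 𝟎𝟏 = here
opposite⇒∈β∩β (e ∷ a) (f ∷ c) zero 𝟏𝟎 = here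
opposite⇒∈β∩β (e ∷ a) (f ∷ c) (suc i) opposite = there (opposite⇒∈β∩β a c i opposite)

antipode : ∀ {n} → Face n → Face n
antipode = map flipE

opposite⇒¬opposite-antipode : ∀ {n} (a c : Face n) i → Opposite (lookup a i) (lookup c i) →
  ¬ Opposite (lookup a i) (lookup (antipode c) i)
opposite⇒¬opposite-antipode a c i opposite rewrite lookup-map i flipE c = flipped opposite
  where
  flipped : ∀ {e f} → Opposite e f → ¬ Opposite e (flipE f)
  flipped 𝟎𝟏 ()
  flipped 𝟏𝟎 ()

β-antipode : ∀ {n} (a : Face n) → β (antipode a) ≡ β a
β-antipode [] = refl
β-antipode (𝟎 ∷ a) = cong (inside ∷_) (β-antipode a)
β-antipode (𝟏 ∷ a) = cong (inside ∷_) (β-antipode a)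
β-antipode (⋆ ∷ a) = cong (outside ∷_) (β-antipode a)

β≡⇒Parallel : ∀ {n} {a c : Face n} → β a ≡ β c → Parallel a c
β≡⇒Parallel {a = a} {c} βa≡βc i = begin
  isStar (lookup a i)           ≡⟨ isStar≡not∘fixedSide (lookup a i) ⟩
  not (fixedSide (lookup a i))  ≡⟨ cong not (lookup-map i fixedSide a) ⟨
  not (lookup (β a) i)          ≡⟨ cong (λ T → not (lookup T i)) βa≡βc ⟩
  not (lookup (β c) i)          ≡⟨ cong not (lookup-map i fixedSide c) ⟩
  not (fixedSide (lookup c i))  ≡⟨ isStar≡not∘fixedSide (lookup c i) ⟨
  isStar (lookup c i)           ∎
  where
  open ≡-Reasoning
  isStar≡not∘fixedSide : ∀ e → isStar e ≡ not (fixedSide e)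
  isStar≡not∘fixedSide 𝟎 = refl
  isStar≡not∘fixedSide 𝟏 = refl
  isStar≡not∘fixedSide ⋆ = refl

Antipodal⇒≡antipode : ∀ {n} {a c : Face n} → Antipodal a c → c ≡ antipode a
Antipodal⇒≡antipode {a = a} {c} (parallel , flipped) = Pointwise-≡⇒≡ (ext entrywise)
  where
  star⇒≡⋆ : ∀ {e} → isStar e ≡ true → e ≡ ⋆
  star⇒≡⋆ {⋆} _ = refl
  entrywise : ∀ i → lookup c i ≡ lookup (antipode a) i
  entrywise i with lookup a i ≟ₑ ⋆
  ... | no aᵢ≢⋆ = trans (flipped i aᵢ≢⋆) (sym (lookup-map i flipE a))
  ... | yes aᵢ≡⋆ = begin
    lookup c i               ≡⟨ star⇒≡⋆ (trans (sym (parallel i)) (cong isStar aᵢ≡⋆)) ⟩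
    ⋆                        ≡⟨ cong flipE aᵢ≡⋆ ⟨
    flipE (lookup a i)       ≡⟨ lookup-map i flipE a ⟨
    lookup (antipode a) i    ∎
    where open ≡-Reasoning

free-in-or-⊆β : ∀ {n} (T : Subset n) (c : Face n) → (∃[ j ] (j ∈ₛ T × c [ j ]= ⋆)) ⊎ T ⊆ β c
free-in-or-⊆β [] [] = inj₂ λ ()
free-in-or-⊆β (s ∷ T) (e ∷ c) with free-in-or-⊆β T c
... | inj₁ (j , j∈T , cⱼ≡⋆) = inj₁ (suc j , there j∈T , there cⱼ≡⋆)
... | inj₂ T⊆βc with s | e
...   | true | ⋆ = inj₁ (zero , here , here)
...   | true | 𝟎 = inj₂ λ { here → here ; (there j∈T) → there (T⊆βc j∈T) }
...   | true | 𝟏 = inj₂ λ { here → here ; (there j∈T) → there (T⊆βc j∈T) }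
...   | false | _ = inj₂ λ { (there j∈T) → there (T⊆βc j∈T) }

∈ᵇ-flipAt : ∀ {n} {a : Face n} {j} (x : Point n) → a [ j ]= ⋆ → (x [ j ]%= not) ∈ᵇ a ≡ x ∈ᵇ a
∈ᵇ-flipAt (h ∷ x) here = refl
∈ᵇ-flipAt {a = e ∷ a} (h ∷ x) (there aⱼ≡⋆) = cong (matchesᵇ h e ∧_) (∈ᵇ-flipAt x aⱼ≡⋆)

-- Parity

parityOn : ∀ {n} → Subset n → Point n → Bool
parityOn [] [] = false
parityOn (s ∷ T) (h ∷ x) = (s ∧ h) xor parityOn T x

parityOn-flipAt : ∀ {n} {T : Subset n} {j} (x : Point n) → j ∈ₛ T →
  parityOn T (x [ j ]%= not) ≡ not (parityOn T x)
parityOn-flipAt (h ∷ x) here = sym (not-distribˡ-xor h _)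
parityOn-flipAt {T = s ∷ T} (h ∷ x) (there j∈T) =
  trans (cong ((s ∧ h) xor_) (parityOn-flipAt x j∈T)) (sym (not-distribʳ-xor (s ∧ h) _))

bit : Entry → Bool
bit 𝟏 = true
bit _ = false

faceParity : ∀ {n} → Face n → Bool
faceParity [] = false
faceParity (e ∷ a) = bit e xor faceParity a

parityOn-β : ∀ {n} (x : Point n) (a : Face n) → x ∈ᵇ a ≡ true → parityOn (β a) x ≡ faceParity a
parityOn-β [] [] _ = refl
parityOn-β (false ∷ x) (𝟎 ∷ a) x∈a = parityOn-β x a x∈a
parityOn-β (true ∷ x) (𝟏 ∷ a) x∈a = cong not (parityOn-β x a x∈a)
parityOn-β (h ∷ x) (⋆ ∷ a) x∈a = parityOn-β x a x∈a
parityOn-β (true ∷ x) (𝟎 ∷ a) ()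
parityOn-β (false ∷ x) (𝟏 ∷ a) ()

offParity : ∀ {n} → Face n → Point n → Bool
offParity b x = parityOn (β b) x xor faceParity b

count : ∀ {n} → Face n → (Point n → Bool) → ℕ
count c p = ∑ (λ x → ⟦ x ∈ᵇ c ⟧ * ⟦ p x ⟧)

offParity-flipAt : ∀ {n} (b : Face n) {j} x → j ∈ₛ β b →
  offParity b (x [ j ]%= not) ≡ not (offParity b x)
offParity-flipAt b x j∈βb = trans (cong (_xor faceParity b) (parityOn-flipAt x j∈βb))
  (sym (not-distribˡ-xor (parityOn (β b) x) (faceParity b)))

offParity-∈ᵇ : ∀ {n} (x : Point n) (b : Face n) → x ∈ᵇ b ≡ true → offParity b x ≡ false
offParity-∈ᵇ x b x∈b =
  trans (cong (_xor faceParity b) (parityOn-β x b x∈b)) (xor-same (faceParity b))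

count-offParity-self : ∀ {n} (b : Face n) → count b (offParity b) ≡ 0
count-offParity-self {n} b = trans (∑-cong outside-b) (∑-zero {n})
  where
  outside-b : ∀ x → ⟦ x ∈ᵇ b ⟧ * ⟦ offParity b x ⟧ ≡ 0
  outside-b x with x ∈ᵇ b in x∈b
  ... | false = refl
  ... | true = cong (λ v → 1 * ⟦ v ⟧) (offParity-∈ᵇ x b x∈b)

count-not-offParity-self : ∀ {n} (b : Face n) → count b (not ∘ offParity b) ≡ 2 ^ dim b
count-not-offParity-self b = trans (∑-cong inside-b) (∑-∈ᵇ b)
  where
  inside-b : ∀ x → ⟦ x ∈ᵇ b ⟧ * ⟦ not (offParity b x) ⟧ ≡ ⟦ x ∈ᵇ b ⟧
  inside-b x with x ∈ᵇ b in x∈b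
  ... | false = refl
  ... | true = cong (λ v → 1 * ⟦ not v ⟧) (offParity-∈ᵇ x b x∈b)

count-offParity-balanced : ∀ {n} (b c : Face n) {j} → j ∈ₛ β b → c [ j ]= ⋆ →
  count c (offParity b) ≡ count c (not ∘ offParity b)
count-offParity-balanced b c {j} j∈βb cⱼ≡⋆ = ∑-balanced j (λ x → ⟦ x ∈ᵇ c ⟧) (offParity b)
  (λ x → cong ⟦_⟧ (∈ᵇ-flipAt x cⱼ≡⋆)) (λ x → offParity-flipAt b x j∈βb)

∑-offParity-balanced : ∀ {n} (b : Face n) {j} → j ∈ₛ β b →
  ∑ (λ x → ⟦ offParity b x ⟧) ≡ ∑ (λ x → ⟦ not (offParity b x) ⟧)
∑-offParity-balanced b {j} j∈βb = begin
  ∑ (λ x → ⟦ offParity b x ⟧)           ≡⟨ ∑-cong (λ x → *-identityˡ ⟦ offParity b x ⟧) ⟨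
  ∑ (λ x → 1 * ⟦ offParity b x ⟧)       ≡⟨ ∑-balanced j (λ _ → 1) (offParity b) (λ _ → refl)
                                             (λ x → offParity-flipAt b x j∈βb) ⟩
  ∑ (λ x → 1 * ⟦ not (offParity b x) ⟧) ≡⟨ ∑-cong (λ x → *-identityˡ ⟦ not (offParity b x) ⟧) ⟩
  ∑ (λ x → ⟦ not (offParity b x) ⟧)     ∎
  where open ≡-Reasoning

-- Antipodal splittings

module Splitting {n k : ℕ} {A : List (Face n)} (S : AntipodalSplitting n k A) where
  open AntipodalSplitting S
  open DecMembership (_≟ᶠ_ {n}) using () renaming (_∈?_ to _∈ₗ?_)

  multiplicity : Point n → ℕ
  multiplicity x = sum (List.map (λ c → ⟦ x ∈ᵇ c ⟧) A)

  1≤multiplicity : ∀ x → 1 ≤ multiplicity x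
  1≤multiplicity x with covers x
  ... | a , a∈A , x∈a =
    ≤-trans (≤-reflexive (cong ⟦_⟧ (sym (∈F⇒∈ᵇ x a x∈a)))) (∈⇒≤sum-map (λ c → ⟦ x ∈ᵇ c ⟧) a∈A)

  ∑-multiplicity : ∑ multiplicity ≡ 2 ^ k * 2 ^ (n ∸ k)
  ∑-multiplicity = begin
    ∑ multiplicity                                 ≡⟨ ∑-sum-map A (λ c x → ⟦ x ∈ᵇ c ⟧) ⟩
    sum (List.map (λ c → ∑ (λ x → ⟦ x ∈ᵇ c ⟧)) A) ≡⟨ sum-map-cong A ∑-face ⟩
    sum (List.map (λ _ → 2 ^ (n ∸ k)) A)           ≡⟨ sum-map-const A _ ⟩
    length A * 2 ^ (n ∸ k)                         ≡⟨ cong (_* 2 ^ (n ∸ k)) size ⟩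
    2 ^ k * 2 ^ (n ∸ k)                            ∎
    where
    open ≡-Reasoning
    ∑-face : ∀ {c} → c ∈ A → ∑ (λ x → ⟦ x ∈ᵇ c ⟧) ≡ 2 ^ (n ∸ k)
    ∑-face {c} c∈A = trans (∑-∈ᵇ c) (cong (2 ^_) (faceDim c∈A))

  -- If k > n the faces are points, so distinctness bounds |A| = 2^k by the 2^n points.
  k≤n : k ≤ n
  k≤n = ≮⇒≥ n≮k
    where
    n≮k : ¬ n < k
    n≮k n<k = <⇒≱ (^-monoʳ-< 2 (s≤s (s≤s z≤n)) n<k) 2^k≤2^n
      where
      n∸k≡0 : n ∸ k ≡ 0
      n∸k≡0 = m≤n⇒m∸n≡0 (<⇒≤ n<k)
      points : ∀ {c} → c ∈ A → dim c ≡ 0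
      points c∈A = trans (faceDim c∈A) n∸k≡0
      multiplicity≤1 : ∀ x → multiplicity x ≤ 1
      multiplicity≤1 x = Unique⇒sum-map-⟦⟧≤1 (x ∈ᵇ_) distinct
        (λ a∈A c∈A → dim≡0-∈ᵇ⇒≡ x (points a∈A) (points c∈A))
      2^k≤2^n : 2 ^ k ≤ 2 ^ n
      2^k≤2^n = begin
        2 ^ k                ≡⟨ *-identityʳ (2 ^ k) ⟨
        2 ^ k * 2 ^ 0        ≡⟨ cong (λ m → 2 ^ k * 2 ^ m) n∸k≡0 ⟨
        2 ^ k * 2 ^ (n ∸ k)  ≡⟨ ∑-multiplicity ⟨
        ∑ multiplicity       ≤⟨ ∑-mono-≤ multiplicity≤1 ⟩
        ∑ {n} (λ _ → 1)      ≡⟨ ∑-one n ⟩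
        2 ^ n                ∎
        where open ≤-Reasoning

  multiplicity≡1 : ∀ x → multiplicity x ≡ 1
  multiplicity≡1 x = ≤-antisym (≮⇒≥ 1≮multiplicity) (1≤multiplicity x)
    where
    ∑-one≡∑-multiplicity : ∑ {n} (λ _ → 1) ≡ ∑ multiplicity
    ∑-one≡∑-multiplicity = begin
      ∑ {n} (λ _ → 1)      ≡⟨ ∑-one n ⟩
      2 ^ n                ≡⟨ cong (2 ^_) (m+[n∸m]≡n k≤n) ⟨
      2 ^ (k + (n ∸ k))    ≡⟨ ^-distribˡ-+-* 2 k (n ∸ k) ⟩
      2 ^ k * 2 ^ (n ∸ k)  ≡⟨ ∑-multiplicity ⟨
      ∑ multiplicity       ∎
      where open ≡-Reasoning
    1≮multiplicity : ¬ 1 < multiplicity x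
    1≮multiplicity 1<mx = <-irrefl ∑-one≡∑-multiplicity (∑-mono-< 1≤multiplicity x 1<mx)

  separated : ∀ {a c} → a ∈ A → c ∈ A → a ≢ c → ∃[ i ] Opposite (lookup a i) (lookup c i)
  separated {a} {c} a∈A c∈A a≢c with separated-or-meet a c
  ... | inj₁ separation = separation
  ... | inj₂ (x , x∈a , x∈c) = contradiction (multiplicity≡1 x) (>⇒≢ 2≤multiplicity)
    where
    2≤multiplicity : 2 ≤ multiplicity x
    2≤multiplicity = subst₂ (λ u v → ⟦ u ⟧ + ⟦ v ⟧ ≤ multiplicity x) x∈a x∈c
      (∈-≢⇒+≤sum-map (λ c → ⟦ x ∈ᵇ c ⟧) a∈A c∈A a≢c)

  ∣β∣≡k : ∀ {c} → c ∈ A → ∣ β c ∣ ≡ k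
  ∣β∣≡k {c} c∈A = +-cancelʳ-≡ (n ∸ k) _ _ (begin
    ∣ β c ∣ + (n ∸ k)  ≡⟨ cong (∣ β c ∣ +_) (faceDim c∈A) ⟨
    ∣ β c ∣ + dim c    ≡⟨ ∣β∣+dim≡n c ⟩
    n                  ≡⟨ m+[n∸m]≡n k≤n ⟨
    k + (n ∸ k)        ∎)
    where open ≡-Reasoning

  ∑-partition : ∀ (w : Point n → ℕ) → sum (List.map (λ c → ∑ (λ x → ⟦ x ∈ᵇ c ⟧ * w x)) A) ≡ ∑ w
  ∑-partition w = begin
    sum (List.map (λ c → ∑ (λ x → ⟦ x ∈ᵇ c ⟧ * w x)) A)  ≡⟨ ∑-sum-map A (λ c x → ⟦ x ∈ᵇ c ⟧ * w x) ⟨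
    ∑ (λ x → sum (List.map (λ c → ⟦ x ∈ᵇ c ⟧ * w x) A))  ≡⟨ ∑-cong (λ x → sum-map-*ʳ A _ (w x)) ⟩
    ∑ (λ x → multiplicity x * w x)
      ≡⟨ ∑-cong (λ x → cong (_* w x) (multiplicity≡1 x)) ⟩
    ∑ (λ x → 1 * w x)                                     ≡⟨ ∑-cong (λ x → *-identityˡ (w x)) ⟩
    ∑ w                                                   ∎
    where open ≡-Reasoning

  ⊆β⇒≡antipode : ∀ {b c} → b ∈ A → c ∈ A → b ≢ c → β b ⊆ β c → c ≡ antipode b
  ⊆β⇒≡antipode b∈A c∈A b≢c βb⊆βc = Antipodal⇒≡antipode (antipodal b∈A c∈A b≢c parallel)
    where
    parallel = β≡⇒Parallel (p⊆q∧∣p∣≡∣q∣⇒p≡q βb⊆βc (trans (∣β∣≡k b∈A) (sym (∣β∣≡k c∈A))))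

  antipode∈A : 1 ≤ k → ∀ {b} → b ∈ A → antipode b ∈ A
  antipode∈A 1≤k {b} b∈A with antipode b ∈ₗ? A
  ... | yes antipode∈ = antipode∈
  ... | no antipode∉ = ⊥-elim (<-irrefl sums-equal (sum-map-mono-< A termwise b∈A b-term))
    where
    j∈βb : ∃[ j ] j ∈ₛ β b
    j∈βb = 0<∣p∣⇒Nonempty (β b) (subst (0 <_) (sym (∣β∣≡k b∈A)) 1≤k)
    sums-equal : sum (List.map (λ c → count c (offParity b)) A)
               ≡ sum (List.map (λ c → count c (not ∘ offParity b)) A)
    sums-equal = begin
      sum (List.map (λ c → count c (offParity b)) A)        ≡⟨ ∑-partition _ ⟩
      ∑ (λ x → ⟦ offParity b x ⟧)                           ≡⟨ ∑-offParity-balanced b (proj₂ j∈βb) ⟩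
      ∑ (λ x → ⟦ not (offParity b x) ⟧)                     ≡⟨ ∑-partition _ ⟨
      sum (List.map (λ c → count c (not ∘ offParity b)) A)  ∎
      where open ≡-Reasoning
    termwise : ∀ {c} → c ∈ A → count c (offParity b) ≤ count c (not ∘ offParity b)
    termwise {c} c∈A with c ≟ᶠ b | free-in-or-⊆β (β b) c
    ... | yes refl | _ = ≤-trans (≤-reflexive (count-offParity-self b)) z≤n
    ... | no c≢b | inj₁ (j , j∈βb , cⱼ≡⋆) = ≤-reflexive (count-offParity-balanced b c j∈βb cⱼ≡⋆)
    ... | no c≢b | inj₂ βb⊆βc =
      contradiction (subst (_∈ A) (⊆β⇒≡antipode b∈A c∈A (c≢b ∘ sym) βb⊆βc) c∈A) antipode∉
    b-term : count b (offParity b) < count b (not ∘ offParity b)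
    b-term rewrite count-offParity-self b | count-not-offParity-self b = m^n>0 2 (dim b)

  ∣β∩β∣≡k : ∀ {a₁ a₂} → a₁ ∈ A → β a₁ ≡ β a₂ → ∣ β a₁ ∩ β a₂ ∣ ≡ k
  ∣β∩β∣≡k {a₁} {a₂} a₁∈A βa₁≡βa₂ = begin
    ∣ β a₁ ∩ β a₂ ∣  ≡⟨ cong (λ T → ∣ β a₁ ∩ T ∣) βa₁≡βa₂ ⟨
    ∣ β a₁ ∩ β a₁ ∣  ≡⟨ cong ∣_∣ (∩-idem (β a₁)) ⟩
    ∣ β a₁ ∣         ≡⟨ ∣β∣≡k a₁∈A ⟩
    k                ∎
    where open ≡-Reasoning

  2≤∣β∩β∣ : 2 ≤ k → ∀ {a₁ a₂} → a₁ ∈ A → a₂ ∈ A → 2 ≤ ∣ β a₁ ∩ β a₂ ∣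
  2≤∣β∩β∣ 2≤k {a₁} {a₂} a₁∈A a₂∈A with a₁ ≟ᶠ a₂ | a₁ ≟ᶠ antipode a₂
  ... | yes refl | _ = subst (2 ≤_) (sym (∣β∩β∣≡k a₁∈A refl)) 2≤k
  ... | no _ | yes refl = subst (2 ≤_) (sym (∣β∩β∣≡k a₁∈A (β-antipode a₂))) 2≤k
  ... | no a₁≢a₂ | no a₁≢a₂′ with separated a₁∈A a₂∈A a₁≢a₂
  ...   | i , opposite with separated a₁∈A (antipode∈A (≤-trans (s≤s z≤n) 2≤k) a₂∈A) a₁≢a₂′
  ...   | j , opposite′ = 2≤∣p∣ (opposite⇒∈β∩β a₁ a₂ i opposite) j∈β∩β i≢j
    where
    j∈β∩β : j ∈ₛ β a₁ ∩ β a₂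
    j∈β∩β = subst (λ T → j ∈ₛ β a₁ ∩ T) (β-antipode a₂) (opposite⇒∈β∩β a₁ (antipode a₂) j opposite′)
    i≢j : i ≢ j
    i≢j refl = opposite⇒¬opposite-antipode a₁ a₂ i opposite opposite′

proposition18 : ∀ (n k : ℕ) → 2 ≤ k → (A : List (Face n)) → AntipodalSplitting n k A →
    ∀ {a₁ a₂} → a₁ ∈ A → a₂ ∈ A → 2 ≤ ∣ β a₁ ∩ β a₂ ∣
proposition18 n k 2≤k A S = Splitting.2≤∣β∩β∣ S 2≤k
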